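{- Let $\Gamma$ be a simple digraph and let $(a,b)\in E(\Gamma)$ be an arc with $(b,a)\notin E(\Gamma)$. If $\Gamma_0$ is the digraph obtained from $\Gamma$ by replacing $(a,b)$ with $(b,a)$, then $|\operatorname{th}(\Gamma_0)-\operatorname{th}(\Gamma)|\le 1$.
   Context: A simple digraph $\Gamma$ has a finite vertex set and no loops or parallel arcs (opposite arcs $(u,v),(v,u)$ allowed). $v$ is an out-neighbor of $u$ if $(u,v)\in E(\Gamma)$. Zero forcing: vertices are blue or white; a blue vertex $u$ with exactly one white out-neighbor $w$ may force $w$ ($u\to w$), turning it blue. A set $\mathcal F$ of forces is a set of forces of $B\subseteq V(\Gamma)$ if, starting with exactly $B$ blue, the forces in $\mathcal F$ can be validly performed in some order after which no further force is possible. Put $\mathcal F^{[0]}=B$ and $\mathcal F^{[t+1]}=\mathcal F^{[t]}\cup\{w\notin\mathcal F^{[t]}:(u\to w)\in\mathcal F,\ u\in\mathcal F^{[t]},\ w$ the only out-neighbor of $u$ outside $\mathcal F^{[t]}\}$; $\operatorname{pt}(\Gamma;\mathcal F)$ is the least $t$ with $\mathcal F^{[t]}=V(\Gamma)$ ($\infty$ if none). $\operatorname{pt}(\Gamma;B)=\min_{\mathcal F}\operatorname{pt}(\Gamma;\mathcal F)$ over sets of forces of $B$. The throttling number is $\operatorname{th}(\Gamma)=\min_{B\subseteq V(\Gamma)}(|B|+\operatorname{pt}(\Gamma;B))$. -}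

module Defs where

open import Data.Nat using (ℕ; zero; suc; _+_; _≤_; _≡ᵇ_)
open import Data.Fin using (Fin)
open import Data.Fin.Properties using () renaming (_≟_ to _≟F_)
open import Data.Bool using (Bool; true; false; _∧_; _∨_; not; if_then_else_)
open import Data.List using (List; []; _∷_; filterᵇ; length)
open import Data.Bool.ListAction using (any)
open import Data.List.Membership.Propositional using (_∈_)
open import Data.Product using (Σ; _×_; _,_; ∃-syntax)
open import Relation.Binary.PropositionalEquality using (_≡_)
open import Relation.Nullary using (¬_; does)
open import Function.Bundles using (_⇔_)
open import Data.List using (allFin) public

-- A simple digraph on the vertex set Fin n: an arc relation without loops.
-- (No parallel arcs automatically; opposite arcs are allowed.)
record Digraph (n : ℕ) : Set where
  field
    arc      : Fin n → Fin n → Bool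
    loopless : ∀ v → arc v v ≡ false
open Digraph public

reverseArc : ∀ {n} → Digraph n → (a b : Fin n) → Fin n → Fin n → Bool
reverseArc Γ a b x y =
  if does (x ≟F a) ∧ does (y ≟F b) then false
  else if does (x ≟F b) ∧ does (y ≟F a) then true
  else arc Γ x y

VSet : ℕ → Set
VSet n = Fin n → Bool

card : ∀ {n} → VSet n → ℕ
card {n} S = length (filterᵇ S (allFin n))

Full : ∀ {n} → VSet n → Set
Full S = ∀ v → S v ≡ true

insert : ∀ {n} → Fin n → VSet n → VSet n
insert w S v = does (v ≟F w) ∨ S v

whiteOut : ∀ {n} → Digraph n → VSet n → Fin n → List (Fin n)
whiteOut {n} Γ S u = filterᵇ (λ w → arc Γ u w ∧ not (S w)) (allFin n)

CanForce : ∀ {n} → Digraph n → VSet n → Fin n → Fin n → Set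
CanForce Γ S u w = (S u ≡ true) × (whiteOut Γ S u ≡ w ∷ [])

Force : ℕ → Set
Force n = Fin n × Fin n

data Chrono {n} (Γ : Digraph n) : VSet n → List (Force n) → VSet n → Set where
  done : ∀ {S} → Chrono Γ S [] S
  step : ∀ {S S' u w fs} → CanForce Γ S u w →
         Chrono Γ (insert w S) fs S' → Chrono Γ S ((u , w) ∷ fs) S'

Terminal : ∀ {n} → Digraph n → VSet n → Set
Terminal Γ S = ∀ u w → ¬ CanForce Γ S u w

ForceSet : ℕ → Set
ForceSet n = Fin n → Fin n → Bool

IsForcesOf : ∀ {n} → Digraph n → VSet n → ForceSet n → Set
IsForcesOf {n} Γ B F =
  Σ (List (Force n)) λ fs → Σ (VSet n) λ S' →
    Chrono Γ B fs S' × Terminal Γ S' ×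
    (∀ u w → (F u w ≡ true) ⇔ ((u , w) ∈ fs))

roundStep : ∀ {n} → Digraph n → ForceSet n → VSet n → VSet n
roundStep {n} Γ F S w =
  S w ∨ any (λ u → S u ∧ F u w ∧ arc Γ u w ∧ not (S w)
                   ∧ (length (whiteOut Γ S u) ≡ᵇ 1)) (allFin n)

iter : ∀ {n} → Digraph n → ForceSet n → VSet n → ℕ → VSet n
iter Γ F B zero    = B
iter Γ F B (suc t) = roundStep Γ F (iter Γ F B t)

-- th(Γ) = k: k = min over B, F (sets of forces of B), t with F^[t] = V of |B| + t.
-- (This is min_B (|B| + min_F min{t : F^[t] = V}), with pt = ∞ never attaining.)
IsThrottlingNumber : ∀ {n} → Digraph n → ℕ → Set
IsThrottlingNumber {n} Γ k =
  (∃[ B ] ∃[ F ] ∃[ t ] (IsForcesOf Γ B F × Full (iter Γ F B t) × k ≡ card B + t))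
  × (∀ B F t → IsForcesOf Γ B F → Full (iter Γ F B t) → k ≤ card B + t)

module Submission where

-- Let Γ₀ arise from Γ by replacing the arc (a , b) with (b , a).  Take a blue set B
-- and a chronological list fs of forces of B in Γ whose rounds colour everything
-- within t rounds.  Add to B the vertex x = b if a forces b in fs, and x = a
-- otherwise, and drop the forces into x.  The remaining forces stay valid in Γ₀:
-- the only arc lost is (a , b), which no remaining force uses, and the only arc
-- gained, (b , a), never gives b an extra white out-neighbour, because a is blue
-- whenever b is.  So Γ₀ is coloured in the same t rounds from a set of size at most
-- |B| + 1, whence th(Γ₀) ≤ th(Γ) + 1, and by symmetry th(Γ) ≤ th(Γ₀) + 1.  Only the
-- fact that Γ and Γ₀ differ in no arcs but (a , b) and (b , a) is used.

open import Defs
open import Data.Nat using (ℕ; zero; suc; _+_; _≤_; _<_; z≤n; s≤s; _≡ᵇ_; _≤?_)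
open import Data.Nat.Properties
  using (≤-refl; ≤-trans; ≤-reflexive; ≤-antisym; n≤1+n; +-suc; m≤m+n; m≤n+m; +-monoˡ-≤; ≡ᵇ⇒≡; anyUpTo?; ≮⇒≥)
import Data.Nat.Properties
open import Data.Nat.Induction using (<-wellFounded)
open import Induction.WellFounded using (Acc; acc)
open import Data.Fin using (Fin)
import Data.Fin as Fin
import Data.Fin.Properties as Fin
open import Data.Fin.Properties using () renaming (_≟_ to _≟F_)
open import Data.Fin.Subset.Properties using (anySubset?)
open import Data.Bool using (Bool; true; false; _∧_; _∨_; not; T; T?; if_then_else_)
open import Data.Bool.Properties using (∨-zeroʳ; ∨-assoc; ∨-comm; T-≡; ¬-not) renaming (_≟_ to _≟B_)
open import Data.Bool.ListAction using (any; or)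
open import Data.List using (List; []; _∷_; filterᵇ; length; tabulate)
import Data.List.Properties as List
open import Data.List.Membership.Propositional using (_∈_)
open import Data.List.Membership.Propositional.Properties using (∈-allFin; ∈-filter⁺; ∈-filter⁻)
open import Data.List.Relation.Unary.Any using (here; there; satisfied)
import Data.List.Relation.Unary.Any as Any
open import Data.List.Relation.Unary.Any.Properties using (any⁺; any⁻)
open import Data.List.Relation.Binary.Sublist.Heterogeneous.Properties using (length-mono-≤; ⊆-filter-Sublist)
import Data.List.Relation.Binary.Sublist.Propositional as Sublist
import Data.Vec as Vec
open import Data.Vec.Properties using (lookup∘tabulate)
open import Data.Product using (_×_; _,_; ∃-syntax; proj₁; proj₂)
import Data.Product.Properties as Product
open import Data.Sum using (_⊎_; inj₁; inj₂; map₁; map₂)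
open import Data.Empty using (⊥-elim)
open import Function using (_∘_; Equivalence; mk⇔)
open import Relation.Nullary using (¬_; Dec; yes; no; does; _×-dec_)
import Relation.Nullary.Decidable as Dec
open import Relation.Binary.PropositionalEquality

true≢false : true ≢ false
true≢false ()

∨-trueʳ : ∀ x {y} → y ≡ true → x ∨ y ≡ true
∨-trueʳ x refl = ∨-zeroʳ x

∧-true⁻ : ∀ {x y} → x ∧ y ≡ true → x ≡ true × y ≡ true
∧-true⁻ {true} {true} _ = refl , refl

true-⇔⇒≡ : ∀ {x y} → (x ≡ true → y ≡ true) → (y ≡ true → x ≡ true) → x ≡ y
true-⇔⇒≡ {false} {false} _ _ = refl
true-⇔⇒≡ {false} {true}  _ y⇒x = y⇒x refl
true-⇔⇒≡ {true}  {false} x⇒y _ = sym (x⇒y refl)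
true-⇔⇒≡ {true}  {true}  _ _ = refl

∧-true⁺ : ∀ {x y} → x ≡ true → y ≡ true → x ∧ y ≡ true
∧-true⁺ refl refl = refl

not-true⁻ : ∀ {x} → not x ≡ true → x ≡ false
not-true⁻ {false} _ = refl

∨-trueˡ : ∀ {x} y → x ≡ true → x ∨ y ≡ true
∨-trueˡ y refl = refl

∨-true⁻ : ∀ {x y} → x ∨ y ≡ true → x ≡ true ⊎ y ≡ true
∨-true⁻ {true}  _ = inj₁ refl
∨-true⁻ {false} e = inj₂ e

≟-true : ∀ {n} {v w : Fin n} → does (v ≟F w) ≡ true → v ≡ w
≟-true {v = v} {w} e with v ≟F w
... | yes v≡w = v≡w

≟-refl : ∀ {n} (v : Fin n) → does (v ≟F v) ≡ true
≟-refl v with v ≟F v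
... | yes _  = refl
... | no v≢v = ⊥-elim (v≢v refl)

≟-false : ∀ {n} {v w : Fin n} → v ≢ w → does (v ≟F w) ≡ false
≟-false {v = v} {w} v≢w with v ≟F w
... | yes v≡w = ⊥-elim (v≢w v≡w)
... | no _    = refl

module _ {A : Set} where

  ∈-filterᵇ⁺ : ∀ {p : A → Bool} {x xs} → x ∈ xs → p x ≡ true → x ∈ filterᵇ p xs
  ∈-filterᵇ⁺ {p} x∈xs px = ∈-filter⁺ (T? ∘ p) x∈xs (Equivalence.from T-≡ px)

  ∈-filterᵇ⁻ : ∀ {p : A → Bool} {x} xs → x ∈ filterᵇ p xs → x ∈ xs × p x ≡ true
  ∈-filterᵇ⁻ {p} xs x∈ with ∈-filter⁻ (T? ∘ p) {xs = xs} x∈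
  ... | x∈xs , px = x∈xs , Equivalence.to T-≡ px

  length-filterᵇ-mono : ∀ {p q : A → Bool} → (∀ x → p x ≡ true → q x ≡ true) →
                        ∀ xs → length (filterᵇ p xs) ≤ length (filterᵇ q xs)
  length-filterᵇ-mono {p} {q} p⇒q xs =
    length-mono-≤ (⊆-filter-Sublist (T? ∘ p) (T? ∘ q) strengthen (Sublist.⊆-refl {x = xs}))
    where
      strengthen : ∀ {x y} → x ≡ y → T (p x) → T (q y)
      strengthen {x} refl px = Equivalence.from T-≡ (p⇒q x (Equivalence.to T-≡ px))

  any-true⁺ : ∀ {p : A → Bool} {x xs} → x ∈ xs → p x ≡ true → any p xs ≡ true
  any-true⁺ {p} x∈xs px =
    Equivalence.to T-≡ (any⁺ p (Any.map (λ { refl → Equivalence.from T-≡ px }) x∈xs))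

  any-true⁻ : ∀ {p : A → Bool} xs → any p xs ≡ true → ∃[ x ] (p x ≡ true)
  any-true⁻ {p} xs e with satisfied (any⁻ p xs (Equivalence.from T-≡ e))
  ... | x , px = x , Equivalence.to T-≡ px

  singleton : ∀ {x} (xs : List A) → length xs ≤ 1 → x ∈ xs → xs ≡ x ∷ []
  singleton (y ∷ [])    _         (here refl) = refl
  singleton (y ∷ _ ∷ _) (s≤s ()) _

  filterᵇ-singleton : ∀ {p q : A → Bool} {x} → (∀ y → p y ≡ true → q y ≡ true) →
                      ∀ xs → filterᵇ q xs ≡ x ∷ [] → p x ≡ true → filterᵇ p xs ≡ x ∷ []
  filterᵇ-singleton {p} {q} {x} p⇒q xs q-single px =
    singleton (filterᵇ p xs)
      (subst (λ ys → length (filterᵇ p xs) ≤ length ys) q-single (length-filterᵇ-mono p⇒q xs))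
      (∈-filterᵇ⁺ x∈xs px)
    where
      x∈xs : x ∈ xs
      x∈xs = proj₁ (∈-filterᵇ⁻ xs (subst (x ∈_) (sym q-single) (here refl)))

module _ {n : ℕ} where

  _≐_ : VSet n → VSet n → Set
  S ≐ S′ = ∀ v → S v ≡ S′ v

  _⊆_ : VSet n → VSet n → Set
  S ⊆ S′ = ∀ v → S v ≡ true → S′ v ≡ true

  ⊆-insert : ∀ (S : VSet n) w → S ⊆ insert w S
  ⊆-insert S w v = ∨-trueʳ (does (v ≟F w))

  ∈-insert : ∀ (S : VSet n) w → insert w S w ≡ true
  ∈-insert S w rewrite ≟-refl w = refl

  insert-cong : ∀ {S S′ : VSet n} w → S ≐ S′ → insert w S ≐ insert w S′
  insert-cong w S≐S′ v = cong (does (v ≟F w) ∨_) (S≐S′ v)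

  insert-comm : ∀ (S : VSet n) w x → insert w (insert x S) ≐ insert x (insert w S)
  insert-comm S w x v = begin
    does (v ≟F w) ∨ (does (v ≟F x) ∨ S v)   ≡⟨ ∨-assoc (does (v ≟F w)) _ _ ⟨
    (does (v ≟F w) ∨ does (v ≟F x)) ∨ S v   ≡⟨ cong (_∨ S v) (∨-comm (does (v ≟F w)) _) ⟩
    (does (v ≟F x) ∨ does (v ≟F w)) ∨ S v   ≡⟨ ∨-assoc (does (v ≟F x)) _ _ ⟩
    does (v ≟F x) ∨ (does (v ≟F w) ∨ S v)   ∎
    where open ≡-Reasoning

  insert-present : ∀ {S : VSet n} {w} → S w ≡ true → insert w S ≐ S
  insert-present {S} {w} Sw v with v ≟F w
  ... | yes refl = sym Sw
  ... | no _     = refl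

count-tabulate : ∀ {A : Set} {m} (g : Fin m → A) (p : A → Bool) →
                 length (filterᵇ p (tabulate g)) ≡ card (p ∘ g)
count-tabulate {m = zero}  g p = refl
count-tabulate {m = suc m} g p with p (g Fin.zero)
... | true  = cong suc (trans (count-tabulate (g ∘ Fin.suc) p) (sym (count-tabulate Fin.suc (p ∘ g))))
... | false = trans (count-tabulate (g ∘ Fin.suc) p) (sym (count-tabulate Fin.suc (p ∘ g)))

card-cong : ∀ {n} {S S' : VSet n} → S ≐ S' → card S ≡ card S'
card-cong {n} S≐S' = cong length (List.filter-≐ _ _ (transport S≐S' , transport (sym ∘ S≐S')) (allFin n))
  where
    transport : ∀ {S S' : VSet n} → S ≐ S' → ∀ {v} → T (S v) → T (S' v)
    transport e {v} = subst T (e v)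

card-≤ : ∀ {n} (S : VSet n) → card S ≤ n
card-≤ {n} S = ≤-trans (List.length-filter _ (allFin n)) (≤-reflexive (List.length-tabulate _))

indicator : Bool → ℕ
indicator b = if b then 1 else 0

card-cons : ∀ {n} (S : VSet (suc n)) → card S ≡ indicator (S Fin.zero) + card (S ∘ Fin.suc)
card-cons S with S Fin.zero
... | true  = cong suc (count-tabulate Fin.suc S)
... | false = count-tabulate Fin.suc S

card-insert-new : ∀ {n} (S : VSet n) w → S w ≡ false → card (insert w S) ≡ suc (card S)
card-insert-new {suc n} S Fin.zero S0 = begin
  card (insert Fin.zero S)                                  ≡⟨ card-cons (insert Fin.zero S) ⟩
  suc (card (S ∘ Fin.suc))                                  ≡⟨ cong (λ b → suc (indicator b + card (S ∘ Fin.suc))) S0 ⟨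
  suc (indicator (S Fin.zero) + card (S ∘ Fin.suc))            ≡⟨ cong suc (card-cons S) ⟨
  suc (card S)                                              ∎
  where open ≡-Reasoning
card-insert-new {suc n} S (Fin.suc w) Sw = begin
  card (insert (Fin.suc w) S)                               ≡⟨ card-cons (insert (Fin.suc w) S) ⟩
  indicator (S Fin.zero) + card (insert w (S ∘ Fin.suc))       ≡⟨ cong (indicator (S Fin.zero) +_) (card-insert-new (S ∘ Fin.suc) w Sw) ⟩
  indicator (S Fin.zero) + suc (card (S ∘ Fin.suc))            ≡⟨ +-suc _ _ ⟩
  suc (indicator (S Fin.zero) + card (S ∘ Fin.suc))            ≡⟨ cong suc (card-cons S) ⟨
  suc (card S)                                              ∎
  where open ≡-Reasoning

card-insert-≤ : ∀ {n} (S : VSet n) w → card (insert w S) ≤ suc (card S)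
card-insert-≤ S w with S w in Sw
... | true  = ≤-trans (≤-reflexive (card-cong (insert-present {S = S} Sw))) (n≤1+n _)
... | false = ≤-reflexive (card-insert-new S w Sw)

least-element : ∀ {P : ℕ → Set} → (∀ k → Dec (P k)) → ∀ m → P m → ∃[ k ] (P k × ∀ j → P j → k ≤ j)
least-element {P} P? m Pm = descend m (<-wellFounded m) Pm
  where
    descend : ∀ m → Acc _<_ m → P m → ∃[ k ] (P k × ∀ j → P j → k ≤ j)
    descend m (acc smaller) Pm with anyUpTo? P? m
    ... | yes (j , j<m , Pj) = descend j (smaller j<m) Pj
    ... | no nothing-below   = m , Pm , λ j Pj → ≮⇒≥ (λ j<m → nothing-below (j , j<m , Pj))

_∈?_ : ∀ {n} (f : Force n) (fs : List (Force n)) → Dec (f ∈ fs)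
f ∈? fs = Any.any? (Product.≡-dec _≟F_ _≟F_ f) fs

module _ {n : ℕ} where

  forcesOf : List (Force n) → ForceSet n
  forcesOf fs u w = does ((u , w) ∈? fs)

  forcesOf⁻ : ∀ {fs u w} → forcesOf fs u w ≡ true → (u , w) ∈ fs
  forcesOf⁻ {fs} {u} {w} e with (u , w) ∈? fs
  ... | yes uw∈fs = uw∈fs
  ... | no _      = ⊥-elim (true≢false (sym e))

  forcesOf⁺ : ∀ {fs u w} → (u , w) ∈ fs → forcesOf fs u w ≡ true
  forcesOf⁺ {fs} {u} {w} uw∈fs with (u , w) ∈? fs
  ... | yes _    = refl
  ... | no uw∉fs = ⊥-elim (uw∉fs uw∈fs)

module Forcing {n} (Γ : Digraph n) where

  ∈-whiteOut⁺ : ∀ {S u w} → arc Γ u w ≡ true → S w ≡ false → w ∈ whiteOut Γ S u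
  ∈-whiteOut⁺ {S} {u} {w} uw Sw =
    ∈-filterᵇ⁺ (∈-allFin w) (subst (λ b → b ∧ not (S w) ≡ true) (sym uw) (cong not Sw))

  ∈-whiteOut⁻ : ∀ {S u w} → w ∈ whiteOut Γ S u → arc Γ u w ≡ true × S w ≡ false
  ∈-whiteOut⁻ {S} {u} {w} w∈ with ∧-true⁻ (proj₂ (∈-filterᵇ⁻ (allFin n) w∈))
  ... | uw , notSw = uw , not-true⁻ notSw

  forced-white : ∀ {S u w} → CanForce Γ S u w → arc Γ u w ≡ true × S w ≡ false
  forced-white (_ , single) = ∈-whiteOut⁻ (subst (_ ∈_) (sym single) (here refl))

  whiteOut-cong : ∀ {S S' : VSet n} → S ≐ S' → ∀ u → whiteOut Γ S u ≡ whiteOut Γ S' u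
  whiteOut-cong S≐S' u =
    List.filter-≐ _ _ (transport S≐S' , transport (sym ∘ S≐S')) (allFin n)
    where
      transport : ∀ {S S' : VSet n} → S ≐ S' → ∀ {v} → T (arc Γ u v ∧ not (S v)) → T (arc Γ u v ∧ not (S' v))
      transport e {v} = subst (λ b → T (arc Γ u v ∧ not b)) (e v)

  canForce-cong : ∀ {S S' : VSet n} → S ≐ S' → ∀ {u w} → CanForce Γ S u w → CanForce Γ S' u w
  canForce-cong S≐S' {u} (Su , single) = trans (sym (S≐S' u)) Su , trans (sym (whiteOut-cong S≐S' u)) single

  chrono-cong : ∀ {S fs S'} → Chrono Γ S fs S' → ∀ {R} → S ≐ R → ∃[ R' ] Chrono Γ R fs R'
  chrono-cong done S≐R = _ , done
  chrono-cong (step {w = w} cf ch) S≐R =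
    let R' , ch' = chrono-cong ch (insert-cong w S≐R) in R' , step (canForce-cong S≐R cf) ch'

  full-terminal : ∀ {S : VSet n} → Full S → Terminal Γ S
  full-terminal full u w cf = true≢false (trans (sym (full w)) (proj₂ (forced-white cf)))

  chrono-⊆ : ∀ {S fs S'} → Chrono Γ S fs S' → S ⊆ S'
  chrono-⊆ done                         v Sv = Sv
  chrono-⊆ (step {S = S} {w = w} _ ch) v Sv = chrono-⊆ ch v (⊆-insert S w v Sv)

  forced-blue-after : ∀ {S fs S' u w} → Chrono Γ S fs S' → (u , w) ∈ fs → S' w ≡ true
  forced-blue-after (step {S = S} {w = w} _ ch) (here refl) = chrono-⊆ ch w (∈-insert S w)
  forced-blue-after (step _ ch)                 (there m)   = forced-blue-after ch m

  forced-white-before : ∀ {S fs S' u w} → Chrono Γ S fs S' → (u , w) ∈ fs → S w ≡ false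
  forced-white-before (step cf _) (here refl) = proj₂ (forced-white cf)
  forced-white-before {S} {w = w} (step {w = w'} _ ch) (there m) with S w in Sw
  ... | false = refl
  ... | true  = ⊥-elim (true≢false (trans (sym (⊆-insert S w' w Sw)) (forced-white-before ch m)))

  unique-forcer : ∀ {S fs S' u u' w} → Chrono Γ S fs S' → (u , w) ∈ fs → (u' , w) ∈ fs → u ≡ u'
  unique-forcer (step _ _)  (here refl) (here refl) = refl
  unique-forcer (step {S = S} {w = w} _ ch) (here refl) (there m) =
    ⊥-elim (true≢false (trans (sym (∈-insert S w)) (forced-white-before ch m)))
  unique-forcer (step {S = S} {w = w} _ ch) (there m) (here refl) =
    ⊥-elim (true≢false (trans (sym (∈-insert S w)) (forced-white-before ch m)))
  unique-forcer (step _ ch) (there m) (there m') = unique-forcer ch m m'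

  chrono-card : ∀ {S fs S'} → Chrono Γ S fs S' → length fs + card S ≤ card S'
  chrono-card done = ≤-refl
  chrono-card {S' = S'} (step {S = S} {w = w} {fs = fs} cf ch) = begin
    suc (length fs) + card S      ≡⟨ +-suc (length fs) (card S) ⟨
    length fs + suc (card S)      ≡⟨ cong (length fs +_) (card-insert-new S w (proj₂ (forced-white cf))) ⟨
    length fs + card (insert w S) ≤⟨ chrono-card ch ⟩
    card S'                       ∎
    where open Data.Nat.Properties.≤-Reasoning

  chrono-length : ∀ {S fs S'} → Chrono Γ S fs S' → length fs ≤ n
  chrono-length {S} {fs} {S'} ch =
    ≤-trans (m≤m+n (length fs) (card S)) (≤-trans (chrono-card ch) (card-≤ S'))

  Fires : ForceSet n → VSet n → Fin n → Fin n → Bool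
  Fires F S u w = S u ∧ F u w ∧ arc Γ u w ∧ not (S w) ∧ (length (whiteOut Γ S u) ≡ᵇ 1)

  fires⁺ : ∀ {F : ForceSet n} {S u w} → F u w ≡ true → CanForce Γ S u w → Fires F S u w ≡ true
  fires⁺ {F} {S} {u} {w} Fuw cf@(Su , single)
    rewrite single | Su | Fuw | proj₁ (forced-white cf) | proj₂ (forced-white cf) = refl

  fires⁻ : ∀ {F : ForceSet n} {S u w} → Fires F S u w ≡ true → F u w ≡ true × CanForce Γ S u w
  fires⁻ {F} {S} {u} {w} e =
    let Su , e₁ = ∧-true⁻ e ; Fuw , e₂ = ∧-true⁻ e₁ ; uw , e₃ = ∧-true⁻ e₂ ; notSw , one = ∧-true⁻ e₃
    in Fuw , Su , singleton (whiteOut Γ S u) (≤-reflexive (≡ᵇ⇒≡ _ 1 (Equivalence.from T-≡ one)))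
                            (∈-whiteOut⁺ uw (not-true⁻ notSw))

  round⁺ : ∀ (F : ForceSet n) {S u w} → F u w ≡ true → CanForce Γ S u w → roundStep Γ F S w ≡ true
  round⁺ F {S} {u} {w} Fuw cf = ∨-trueʳ (S w) (any-true⁺ (∈-allFin u) (fires⁺ {F} Fuw cf))

  round⁻ : ∀ (F : ForceSet n) S {w} → roundStep Γ F S w ≡ true →
           S w ≡ true ⊎ ∃[ u ] (F u w ≡ true × CanForce Γ S u w)
  round⁻ F S {w} e with ∨-true⁻ {S w} e
  ... | inj₁ Sw    = inj₁ Sw
  ... | inj₂ fires with any-true⁻ (allFin n) fires
  ...   | u , Fires-uw = inj₂ (u , fires⁻ {F} {S} Fires-uw)

  iter-⊆-suc : ∀ (F : ForceSet n) B t → iter Γ F B t ⊆ iter Γ F B (suc t)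
  iter-⊆-suc F B t v Rv = ∨-trueˡ _ Rv

  iter-cong : ∀ {F G : ForceSet n} {S S' : VSet n} → (∀ u w → F u w ≡ G u w) → S ≐ S' →
              ∀ t → iter Γ F S t ≐ iter Γ G S' t
  iter-cong F≐G S≐S' zero    = S≐S'
  iter-cong {F} {G} {S} {S'} F≐G S≐S' (suc t) w =
    cong₂ _∨_ (R≐R' w) (cong or (List.map-cong fires-cong (allFin n)))
    where
      R≐R' : iter Γ F S t ≐ iter Γ G S' t
      R≐R' = iter-cong F≐G S≐S' t

      fires-cong : ∀ u → Fires F (iter Γ F S t) u w ≡ Fires G (iter Γ G S' t) u w
      fires-cong u = cong₂ _∧_ (R≐R' u) (cong₂ _∧_ (F≐G u w)
        (cong₂ (λ s ws → arc Γ u w ∧ not s ∧ (length ws ≡ᵇ 1)) (R≐R' w) (whiteOut-cong R≐R' u)))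

  iter-⊆-final : ∀ {B fs S'} → Chrono Γ B fs S' → ∀ t → iter Γ (forcesOf fs) B t ⊆ S'
  iter-⊆-final ch zero = chrono-⊆ ch
  iter-⊆-final {B} {fs} ch (suc t) w e with round⁻ (forcesOf fs) (iter Γ (forcesOf fs) B t) e
  ... | inj₁ Rw            = iter-⊆-final ch t w Rw
  ... | inj₂ (_ , Fuw , _) = forced-blue-after ch (forcesOf⁻ Fuw)

  -- If u forces w in a chronological list, then in every round in which w is blue, u is blue:
  -- w is white initially, and only u can force it.
  forcer-first : ∀ {B fs S' u w} → Chrono Γ B fs S' → (u , w) ∈ fs →
                 ∀ t → iter Γ (forcesOf fs) B t w ≡ true → iter Γ (forcesOf fs) B t u ≡ true
  forcer-first ch uw∈fs zero Bw = ⊥-elim (true≢false (trans (sym Bw) (forced-white-before ch uw∈fs)))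
  forcer-first {B} {fs} {u = u} {w} ch uw∈fs (suc t) e with round⁻ (forcesOf fs) (iter Γ (forcesOf fs) B t) e
  ... | inj₁ Rw = iter-⊆-suc (forcesOf fs) B t u (forcer-first ch uw∈fs t Rw)
  ... | inj₂ (u′ , Fu′w , Ru′ , _) with unique-forcer ch (forcesOf⁻ {fs = fs} {u′} {w} Fu′w) uw∈fs
  ...   | refl = iter-⊆-suc (forcesOf fs) B t u Ru′

Chronological : ∀ {n} → Digraph n → VSet n → List (Force n) → Set
Chronological Γ B fs = ∃[ S' ] Chrono Γ B fs S'

ThrottlesWithin : ∀ {n} → Digraph n → ℕ → VSet n → Set
ThrottlesWithin {n} Γ k B =
  ∃[ fs ] (length fs ≤ n × Chronological Γ B fs ×
           ∃[ t ] (Full (iter Γ (forcesOf fs) B t) × card B + t ≤ k))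

Achievable : ∀ {n} → Digraph n → ℕ → Set
Achievable Γ k = ∃[ B ] ThrottlesWithin Γ k B

module Throttling {n} (Γ : Digraph n) where
  open Forcing Γ

  achievable : ∀ {B F t} → IsForcesOf Γ B F → Full (iter Γ F B t) → Achievable Γ (card B + t)
  achievable {B} {F} {t} (fs , S' , ch , _ , F⇔fs) full =
    B , fs , chrono-length ch , (S' , ch) , t ,
    (λ v → trans (sym (iter-cong F≐fs (λ _ → refl) t v)) (full v)) , ≤-refl
    where
      F≐fs : ∀ u w → F u w ≡ forcesOf fs u w
      F≐fs u w = true-⇔⇒≡ (forcesOf⁺ ∘ Equivalence.to (F⇔fs u w)) (Equivalence.from (F⇔fs u w) ∘ forcesOf⁻)

  -- Conversely, an achievable value bounds |B| + t for a genuine set of forces of B: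
  -- the chronological list ends in a full, hence terminal, blue set.
  forces-of-witness : ∀ {k B} → ThrottlesWithin Γ k B →
              ∃[ F ] ∃[ t ] (IsForcesOf Γ B F × Full (iter Γ F B t) × card B + t ≤ k)
  forces-of-witness (fs , _ , (S' , ch) , t , full , cost) =
    forcesOf fs , t ,
    (fs , S' , ch , full-terminal (λ v → iter-⊆-final ch t v (full v)) ,
     λ u w → mk⇔ forcesOf⁻ forcesOf⁺) ,
    full , cost

  all-blue : Achievable Γ (card {n} (λ _ → true) + 0)
  all-blue = (λ _ → true) , [] , z≤n , (_ , done) , 0 , (λ _ → refl) , ≤-refl

  canForce? : ∀ S u w → Dec (CanForce Γ S u w)
  canForce? S u w = (S u ≟B true) ×-dec List.≡-dec _≟F_ (whiteOut Γ S u) (w ∷ [])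

  full? : (S : VSet n) → Dec (Full S)
  full? S = Fin.all? (λ v → S v ≟B true)

  Search : ℕ → VSet n → (List (Force n) → Set) → Set
  Search ℓ S P = ∃[ fs ] (length fs ≤ ℓ × Chronological Γ S fs × P fs)

  -- Such a list is empty or starts with a possible force; so the search is decidable.
  search? : ∀ ℓ S {P : List (Force n) → Set} → (∀ fs → Dec (P fs)) → Dec (Search ℓ S P)
  search? ℓ S P? with P? []
  ... | yes P[] = yes ([] , z≤n , (S , done) , P[])
  search? zero S P? | no ¬P[] = no λ where
    ([] , _ , _ , P[]) → ¬P[] P[]
  search? (suc ℓ) S {P} P? | no ¬P[] =
    Dec.map′ extend restrict
      (Fin.any? λ u → Fin.any? λ w →
        canForce? S u w ×-dec search? ℓ (insert w S) (λ fs → P? ((u , w) ∷ fs)))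
    where
      extend : ∃[ u ] ∃[ w ] (CanForce Γ S u w × Search ℓ (insert w S) (P ∘ ((u , w) ∷_))) →
               Search (suc ℓ) S P
      extend (u , w , cf , fs , len , (S' , ch) , Pfs) = (u , w) ∷ fs , s≤s len , (S' , step cf ch) , Pfs
      restrict : Search (suc ℓ) S P →
                 ∃[ u ] ∃[ w ] (CanForce Γ S u w × Search ℓ (insert w S) (P ∘ ((u , w) ∷_)))
      restrict ([] , _ , _ , P[]) = ⊥-elim (¬P[] P[])
      restrict ((u , w) ∷ fs , s≤s len , (S' , step cf ch) , Pfs) = u , w , cf , fs , len , (S' , ch) , Pfs

  -- The number of rounds is at most k, so it can be searched for too.
  throttlesWithin? : ∀ k B → Dec (ThrottlesWithin Γ k B)
  throttlesWithin? k B = search? n B rounds?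
    where
      rounds? : ∀ fs → Dec (∃[ t ] (Full (iter Γ (forcesOf fs) B t) × card B + t ≤ k))
      rounds? fs = Dec.map′ (λ (t , _ , done-by-t) → t , done-by-t)
                            (λ (t , done-by-t) → t , s≤s (≤-trans (m≤n+m t (card B)) (proj₂ done-by-t)) , done-by-t)
                            (anyUpTo? (λ t → full? (iter Γ (forcesOf fs) B t) ×-dec (card B + t ≤? k)) (suc k))

  throttlesWithin-cong : ∀ {k B B'} → B ≐ B' → ThrottlesWithin Γ k B → ThrottlesWithin Γ k B'
  throttlesWithin-cong {k} B≐B' (fs , len , (_ , ch) , t , full , cost)
    = fs , len , chrono-cong ch B≐B' , t ,
    (λ v → trans (sym (iter-cong (λ _ _ → refl) B≐B' t v)) (full v)) ,
    subst (λ c → c + t ≤ k) (card-cong B≐B') cost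

  -- Blue sets range over the finitely many subsets of the vertices.
  achievable? : ∀ k → Dec (Achievable Γ k)
  achievable? k = Dec.map′ (λ (s , w) → Vec.lookup s , w)
                           (λ (B , w) → Vec.tabulate B , throttlesWithin-cong (λ v → sym (lookup∘tabulate B v)) w)
                           (anySubset? (λ s → throttlesWithin? k (Vec.lookup s)))

  throttling-number : ∃[ k ] (IsThrottlingNumber Γ k × ∀ j → Achievable Γ j → k ≤ j)
  throttling-number with least-element achievable? _ all-blue
  ... | k , (B , witness) , least with forces-of-witness witness
  ...   | F , t , isForces , full , cost =
    k , ((B , F , t , isForces , full , ≤-antisym (least _ (achievable isForces full)) cost) ,
         (λ B' F' t' isForces' full' → least _ (achievable isForces' full'))) ,
    least

  throttling-achievable : ∀ {k} → IsThrottlingNumber Γ k → Achievable Γ k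
  throttling-achievable ((B , F , t , isForces , full , refl) , _) = achievable isForces full

module ArcReversal {n} (Γ Γ₀ : Digraph n) (a b : Fin n)
  (arc₀⇒arc : ∀ u v → arc Γ₀ u v ≡ true → arc Γ u v ≡ true ⊎ (u ≡ b × v ≡ a))
  (arc⇒arc₀ : ∀ u v → arc Γ u v ≡ true → arc Γ₀ u v ≡ true ⊎ (u ≡ a × v ≡ b)) where

  open Forcing Γ
  module Γ₀ = Forcing Γ₀

  force-transfer : ∀ {S S₀ u w} → CanForce Γ S u w → S ⊆ S₀ → S₀ w ≡ false →
                   ¬ (u ≡ a × w ≡ b) → (u ≡ b → S₀ a ≡ true) → CanForce Γ₀ S₀ u w
  force-transfer {S} {S₀} {u} {w} cf@(Su , single) S⊆S₀ S₀w not-ab b⇒a =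
    S⊆S₀ u Su , filterᵇ-singleton white₀⇒white (allFin n) single (∧-true⁺ arc₀-uw (cong not S₀w))
    where
      arc₀-uw : arc Γ₀ u w ≡ true
      arc₀-uw with arc⇒arc₀ u w (proj₁ (forced-white cf))
      ... | inj₁ uw₀ = uw₀
      ... | inj₂ ab  = ⊥-elim (not-ab ab)

      white₀⇒white : ∀ v → arc Γ₀ u v ∧ not (S₀ v) ≡ true → arc Γ u v ∧ not (S v) ≡ true
      white₀⇒white v e with ∧-true⁻ e
      ... | uv₀ , notS₀v with S v in Sv
      ...   | true = ⊥-elim (true≢false (trans (sym (S⊆S₀ v Sv)) (not-true⁻ notS₀v)))
      ...   | false with arc₀⇒arc u v uv₀
      ...     | inj₁ uv              = ∧-true⁺ uv refl
      ...     | inj₂ (refl , refl)   = ⊥-elim (true≢false (trans (sym (b⇒a refl)) (not-true⁻ notS₀v)))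

  -- What makes forces from b valid in Γ₀: a is blue there, or b is still white in Γ
  -- and only a forces b later on.
  data ReadyForB (S S₀ : VSet n) (fs : List (Force n)) : Set where
    a-blue  : S₀ a ≡ true → ReadyForB S S₀ fs
    b-later : S b ≡ false → (∀ u → (u , b) ∈ fs → u ≡ a) → ReadyForB S S₀ fs

  ready-use : ∀ {S S₀ fs} → ReadyForB S S₀ fs → S b ≡ true → S₀ a ≡ true
  ready-use (a-blue S₀a)   _   = S₀a
  ready-use (b-later Sb _) Sb′ = ⊥-elim (true≢false (trans (sym Sb′) Sb))

  ready-step : ∀ {S S₀ S₀′ u w fs} → ReadyForB S S₀ ((u , w) ∷ fs) → S u ≡ true →
               S ⊆ S₀ → S₀ ⊆ S₀′ → ReadyForB (insert w S) S₀′ fs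
  ready-step (a-blue S₀a) _ _ S₀⊆S₀′ = a-blue (S₀⊆S₀′ a S₀a)
  ready-step {S} {u = u} {w} (b-later Sb only-a) Su S⊆S₀ S₀⊆S₀′ with w ≟F b
  ... | yes refl with only-a u (here refl)
  ...   | refl = a-blue (S₀⊆S₀′ a (S⊆S₀ a Su))
  ready-step {S} {u = u} {w} (b-later Sb only-a) Su S⊆S₀ S₀⊆S₀′ | no w≢b =
    b-later (trans (cong (_∨ S b) (≟-false (w≢b ∘ sym))) Sb) (λ u′ m → only-a u′ (there m))

  module AddBlue (x : Fin n) where

    withoutInto : List (Force n) → List (Force n)
    withoutInto = filterᵇ (λ (_ , w) → not (does (w ≟F x)))

    ≐-insert⇒⊆ : ∀ {S S₀ : VSet n} → S₀ ≐ insert x S → S ⊆ S₀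
    ≐-insert⇒⊆ {S} S₀≐ v Sv = trans (S₀≐ v) (⊆-insert S x v Sv)

    -- Simulation of a chronological list of Γ by one of Γ₀ whose blue sets have x added;
    -- a force into x is skipped, since x is blue already.
    simulate : ∀ {S fs S'} → Chrono Γ S fs S' → ∀ {S₀} → S₀ ≐ insert x S → ReadyForB S S₀ fs →
               ((a , b) ∈ fs → b ≡ x) → Chronological Γ₀ S₀ (withoutInto fs)
    simulate done _ _ _ = _ , done
    simulate (step {S = S} {u = u} {w = w} cf ch) {S₀} S₀≐ ready ab⇒x with w ≟F x
    ... | yes refl =
      simulate ch (λ v → trans (S₀≐ v) (sym (insert-present (∈-insert S w) v)))
               (ready-step ready (proj₁ cf) (≐-insert⇒⊆ S₀≐) (λ _ S₀v → S₀v)) (ab⇒x ∘ there)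
    ... | no w≢x =
      let S₀' , ch₀ = simulate ch (λ v → trans (insert-cong w S₀≐ v) (insert-comm S w x v))
                               (ready-step ready (proj₁ cf) (≐-insert⇒⊆ S₀≐) (⊆-insert S₀ w)) (ab⇒x ∘ there)
      in S₀' , step cf₀ ch₀
      where
        cf₀ : CanForce Γ₀ S₀ u w
        cf₀ = force-transfer cf (≐-insert⇒⊆ S₀≐)
                (trans (S₀≐ w) (cong₂ _∨_ (≟-false w≢x) (proj₂ (forced-white cf))))
                (λ { (refl , refl) → w≢x (ab⇒x (here refl)) })
                (λ { refl → ready-use ready (proj₁ cf) })

    module Rounds (B : VSet n) (fs : List (Force n)) (ab⇒x : (a , b) ∈ fs → b ≡ x)
      (b⇒a : ∀ t → iter Γ (forcesOf fs) B t b ≡ true → iter Γ (forcesOf fs) B t a ≡ true ⊎ x ≡ a) where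

      F₀ : ForceSet n
      F₀ = forcesOf (withoutInto fs)

      R₀ : ℕ → VSet n
      R₀ = iter Γ₀ F₀ (insert x B)

      x-blue : ∀ t → R₀ t x ≡ true
      x-blue zero    = ∈-insert B x
      x-blue (suc t) = Γ₀.iter-⊆-suc F₀ (insert x B) t x (x-blue t)

      keeps-up : ∀ t → iter Γ (forcesOf fs) B t ⊆ R₀ t
      keeps-up zero    = ⊆-insert B x
      keeps-up (suc t) w e with round⁻ (forcesOf fs) (iter Γ (forcesOf fs) B t) e
      ... | inj₁ Rw = Γ₀.iter-⊆-suc F₀ (insert x B) t w (keeps-up t w Rw)
      ... | inj₂ (u , Fuw , cf) with R₀ t w ≟B true
      ...   | yes R₀w   = Γ₀.iter-⊆-suc F₀ (insert x B) t w R₀w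
      ...   | no R₀w≢true = Γ₀.round⁺ F₀ F₀uw (force-transfer cf (keeps-up t) R₀w not-ab ready)
        where
          R₀w : R₀ t w ≡ false
          R₀w = ¬-not R₀w≢true
          uw∈fs : (u , w) ∈ fs
          uw∈fs = forcesOf⁻ Fuw
          w≢x : w ≢ x
          w≢x refl = true≢false (trans (sym (x-blue t)) R₀w)
          F₀uw : F₀ u w ≡ true
          F₀uw = forcesOf⁺ (∈-filterᵇ⁺ uw∈fs (cong not (≟-false w≢x)))
          not-ab : ¬ (u ≡ a × w ≡ b)
          not-ab (refl , refl) = w≢x (ab⇒x uw∈fs)
          ready : u ≡ b → R₀ t a ≡ true
          ready refl with b⇒a t (proj₁ cf)
          ... | inj₁ Ra   = keeps-up t a Ra
          ... | inj₂ refl = x-blue t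

  add-blue : ∀ {k B fs S' t} → Chrono Γ B fs S' → length fs ≤ n → Full (iter Γ (forcesOf fs) B t) →
             card B + t ≤ k → ∀ x → ((a , b) ∈ fs → b ≡ x) → ReadyForB B (insert x B) fs →
             (∀ s → iter Γ (forcesOf fs) B s b ≡ true → iter Γ (forcesOf fs) B s a ≡ true ⊎ x ≡ a) →
             Achievable Γ₀ (suc k)
  add-blue {B = B} {fs} {t = t} ch len full cost x ab⇒x ready b⇒a =
    insert x B , withoutInto fs , ≤-trans (List.length-filter _ fs) len ,
    simulate ch (λ _ → refl) ready ab⇒x , t ,
    (λ v → Rounds.keeps-up B fs ab⇒x b⇒a t v (full v)) ,
    ≤-trans (+-monoˡ-≤ t (card-insert-≤ B x)) (s≤s cost)
    where open AddBlue x

  -- Add b if a forces b, and a otherwise.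
  transfer : ∀ {k} → Achievable Γ k → Achievable Γ₀ (suc k)
  transfer (B , fs , len , (_ , ch) , t , full , cost) with (a , b) ∈? fs
  ... | yes ab∈fs =
    add-blue ch len full cost b (λ _ → refl)
      (b-later (forced-white-before ch ab∈fs) (λ u ub∈fs → unique-forcer ch ub∈fs ab∈fs))
      (λ s Rb → inj₁ (forcer-first ch ab∈fs s Rb))
  ... | no ab∉fs =
    add-blue ch len full cost a (λ ab∈fs → ⊥-elim (ab∉fs ab∈fs)) (a-blue (∈-insert B a)) (λ _ _ → inj₂ refl)

if-true⁻ : ∀ p q r → (if p then false else if q then true else r) ≡ true → r ≡ true ⊎ q ≡ true
if-true⁻ false true  r _ = inj₂ refl
if-true⁻ false false r e = inj₁ e

if-true⁺ : ∀ p q {r} → r ≡ true → (if p then false else if q then true else r) ≡ true ⊎ p ≡ true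
if-true⁺ true  q     _ = inj₂ refl
if-true⁺ false true  _ = inj₁ refl
if-true⁺ false false e = inj₁ e

≟-pair : ∀ {n} {u v a b : Fin n} → does (u ≟F a) ∧ does (v ≟F b) ≡ true → u ≡ a × v ≡ b
≟-pair e with ∧-true⁻ e
... | ua , vb = ≟-true ua , ≟-true vb

module _ {n} (Γ : Digraph n) (a b : Fin n) where

  reverseArc⇒arc : ∀ u v → reverseArc Γ a b u v ≡ true → arc Γ u v ≡ true ⊎ (u ≡ b × v ≡ a)
  reverseArc⇒arc u v e = map₂ ≟-pair (if-true⁻ (does (u ≟F a) ∧ does (v ≟F b)) _ _ e)

  arc⇒reverseArc : ∀ u v → arc Γ u v ≡ true → reverseArc Γ a b u v ≡ true ⊎ (u ≡ a × v ≡ b)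
  arc⇒reverseArc u v e = map₂ ≟-pair (if-true⁺ (does (u ≟F a) ∧ does (v ≟F b)) (does (u ≟F b) ∧ does (v ≟F a)) e)

corollary2p9 : ∀ {n} (Γ : Digraph n) (a b : Fin n) → arc Γ a b ≡ true → arc Γ b a ≡ false →
    (Γ₀ : Digraph n) → (∀ x y → arc Γ₀ x y ≡ reverseArc Γ a b x y) →
    ∃[ t ] ∃[ t₀ ] (IsThrottlingNumber Γ t × IsThrottlingNumber Γ₀ t₀ × t₀ ≤ suc t × t ≤ suc t₀)
corollary2p9 Γ a b _ _ Γ₀ arc₀≡ with Throttling.throttling-number Γ | Throttling.throttling-number Γ₀
... | t , th , least | t₀ , th₀ , least₀ =
  t , t₀ , th , th₀ ,
  least₀ _ (ArcReversal.transfer Γ Γ₀ a b new old (Throttling.throttling-achievable Γ th)) ,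
  least  _ (ArcReversal.transfer Γ₀ Γ b a old new (Throttling.throttling-achievable Γ₀ th₀))
  where
    new : ∀ u v → arc Γ₀ u v ≡ true → arc Γ u v ≡ true ⊎ (u ≡ b × v ≡ a)
    new u v e = reverseArc⇒arc Γ a b u v (trans (sym (arc₀≡ u v)) e)

    old : ∀ u v → arc Γ u v ≡ true → arc Γ₀ u v ≡ true ⊎ (u ≡ a × v ≡ b)
    old u v e = map₁ (trans (arc₀≡ u v)) (arc⇒reverseArc Γ a b u v e)
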